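{- Let $G$ be a finite semiabelian group. Then there exist finite cyclic groups $C_1,\dots,C_r$ and an epimorphism $C_1\wr(C_2\wr(\cdots\wr C_r)\cdots)\to G$.
   Context: A finite group is semiabelian if it belongs to the smallest family $\mathcal{SA}$ of finite groups such that: (i) every finite abelian group is in $\mathcal{SA}$; (ii) if $G\in\mathcal{SA}$ and $A$ is finite abelian then every semidirect product $A\rtimes G$ is in $\mathcal{SA}$; (iii) every homomorphic image of a group in $\mathcal{SA}$ is in $\mathcal{SA}$. For groups $H,G$, the standard wreath product $H\wr G$ is the set of pairs $(f,g)$, $f:G\to H$ a function, $g\in G$, with multiplication $(f_1,g_1)(f_2,g_2)=(f_1f_2^{g_1^{ -1}},g_1g_2)$, where $f^{g^{ -1}}(x)=f(xg)$. -}

module Defs where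

open import Level using (Level; _⊔_; 0ℓ) renaming (suc to lsuc)
open import Algebra.Bundles using (Group; AbelianGroup; RawGroup)
open import Algebra.Structures using (IsGroup)
open import Algebra.Morphism.Structures using (module GroupMorphisms)
import Algebra.Properties.Group as GP
open import Data.Nat using (ℕ; zero; suc)
open import Data.Integer using (ℤ; +_; -[1+_])
open import Data.Fin using (Fin)
open import Data.Product using (Σ; ∃; _×_; _,_; proj₁; proj₂)
open import Data.List using (List; []; _∷_)

private variable a aℓ g gℓ h hℓ c ℓ : Level

Finite : Group c ℓ → Set (c ⊔ ℓ)
Finite G = Σ ℕ λ n → Σ (Fin n → Carrier) λ e → ∀ x → Σ (Fin n) λ i → e i ≈ x
  where open Group G

module _ (G : Group c ℓ) where
  open Group G

  powℕ : Carrier → ℕ → Carrier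
  powℕ x zero    = ε
  powℕ x (suc n) = x ∙ powℕ x n

  powℤ : Carrier → ℤ → Carrier
  powℤ x (+ n)     = powℕ x n
  powℤ x -[1+ n ]  = powℕ (x ⁻¹) (suc n)

  IsCyclic : Set (c ⊔ ℓ)
  IsCyclic = Σ Carrier λ γ → ∀ x → Σ ℤ λ k → x ≈ powℤ γ k

FiniteCyclic : Group c ℓ → Set (c ⊔ ℓ)
FiniteCyclic G = Finite G × IsCyclic G

IsEpimorphism : (G : Group g gℓ) (H : Group h hℓ) →
                (Group.Carrier G → Group.Carrier H) → Set (g ⊔ gℓ ⊔ h ⊔ hℓ)
IsEpimorphism G H f =
  GroupMorphisms.IsGroupHomomorphism (Group.rawGroup G) (Group.rawGroup H) f
  × (∀ y → Σ (Group.Carrier G) λ x → Group._≈_ H (f x) y)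

record Action (G : Group g gℓ) (A : Group a aℓ) : Set (g ⊔ gℓ ⊔ a ⊔ aℓ) where
  private
    module G = Group G
    module A = Group A
  field
    act      : G.Carrier → A.Carrier → A.Carrier
    act-cong : ∀ {g g' x y} → g G.≈ g' → x A.≈ y → act g x A.≈ act g' y
    act-hom  : ∀ g x y → act g (x A.∙ y) A.≈ (act g x A.∙ act g y)
    act-id   : ∀ x → act G.ε x A.≈ x
    act-comp : ∀ g h x → act (g G.∙ h) x A.≈ act g (act h x)

semidirect : (A : Group a aℓ) (G : Group g gℓ) → Action G A → Group (a ⊔ g) (aℓ ⊔ gℓ)
semidirect A G φ = record
  { Carrier = A.Carrier × G.Carrier
  ; _≈_ = λ p q → (proj₁ p A.≈ proj₁ q) × (proj₂ p G.≈ proj₂ q)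
  ; _∙_ = mul
  ; ε = (A.ε , G.ε)
  ; _⁻¹ = inv
  ; isGroup = record
    { isMonoid = record
      { isSemigroup = record
        { isMagma = record
          { isEquivalence = record
            { refl = A.refl , G.refl
            ; sym = λ (p , q) → A.sym p , G.sym q
            ; trans = λ (p , q) (p' , q') → A.trans p p' , G.trans q q' }
          ; ∙-cong = λ (p , q) (p' , q') → A.∙-cong p (act-cong q p') , G.∙-cong q q' }
        ; assoc = λ (x , g) (y , h) (z , k) →
            A.trans (A.assoc _ _ _)
              (A.∙-congˡ (A.trans (A.∙-congˡ (act-comp g h z)) (A.sym (act-hom g y (act h z)))))
            , G.assoc g h k }
      ; identity = (λ (x , g) → A.trans (A.identityˡ _) (act-id x) , G.identityˡ g)
                 , (λ (x , g) → A.trans (A.∙-congˡ (actε g)) (A.identityʳ x) , G.identityʳ g) }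
    ; inverse = (λ (x , g) → A.trans (A.sym (act-hom (g G.⁻¹) (x A.⁻¹) x))
                                (A.trans (act-cong G.refl (A.inverseˡ x)) (actε _))
                             , G.inverseˡ g)
              , (λ (x , g) → A.trans (A.∙-congˡ (A.trans (A.sym (act-comp g (g G.⁻¹) (x A.⁻¹)))
                                 (A.trans (act-cong (G.inverseʳ g) A.refl) (act-id _))))
                                (A.inverseʳ x)
                             , G.inverseʳ g)
    ; ⁻¹-cong = λ (p , q) → act-cong (G.⁻¹-cong q) (A.⁻¹-cong p) , G.⁻¹-cong q } }
  where
  module A = Group A
  module G = Group G
  open Action φ
  mul : A.Carrier × G.Carrier → A.Carrier × G.Carrier → A.Carrier × G.Carrier
  mul (x , g) (y , h) = (x A.∙ act g y , g G.∙ h)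
  inv : A.Carrier × G.Carrier → A.Carrier × G.Carrier
  inv (x , g) = (act (g G.⁻¹) (x A.⁻¹) , g G.⁻¹)
  actε : ∀ g → act g A.ε A.≈ A.ε
  actε g = GP.identityʳ-unique A (act g A.ε) (act g A.ε)
             (A.trans (A.sym (act-hom g A.ε A.ε)) (act-cong G.refl (A.identityˡ A.ε)))

-- Standard wreath product H ≀ G: pairs (f , g) with f : G → H a function
-- (respecting the equality of G) and g ∈ G, with
-- (f₁ , g₁)(f₂ , g₂) = (x ↦ f₁(x) f₂(x g₁) , g₁ g₂).

module _ (H : Group h hℓ) (G : Group g gℓ) where
  private
    module H = Group H
    module G = Group G

  record WrEl : Set (h ⊔ hℓ ⊔ g ⊔ gℓ) where
    constructor wr
    field
      fn   : G.Carrier → H.Carrier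
      resp : ∀ {x y} → x G.≈ y → fn x H.≈ fn y
      base : G.Carrier
  open WrEl

  _≈W_ : WrEl → WrEl → Set (g ⊔ hℓ ⊔ gℓ)
  u ≈W v = (∀ x → fn u x H.≈ fn v x) × (base u G.≈ base v)

  wmul : WrEl → WrEl → WrEl
  wmul u v = wr (λ x → fn u x H.∙ fn v (x G.∙ base u))
                (λ p → H.∙-cong (resp u p) (resp v (G.∙-congʳ p)))
                (base u G.∙ base v)

  weps : WrEl
  weps = wr (λ _ → H.ε) (λ _ → H.refl) G.ε

  winv : WrEl → WrEl
  winv u = wr (λ x → fn u (x G.∙ base u G.⁻¹) H.⁻¹)
              (λ p → H.⁻¹-cong (resp u (G.∙-congʳ p)))
              (base u G.⁻¹)

  _≀_ : Group (h ⊔ hℓ ⊔ g ⊔ gℓ) (g ⊔ hℓ ⊔ gℓ)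
  _≀_ = record
    { Carrier = WrEl
    ; _≈_ = _≈W_
    ; _∙_ = wmul
    ; ε = weps
    ; _⁻¹ = winv
    ; isGroup = record
      { isMonoid = record
        { isSemigroup = record
          { isMagma = record
            { isEquivalence = record
              { refl = (λ _ → H.refl) , G.refl
              ; sym = λ (p , q) → (λ x → H.sym (p x)) , G.sym q
              ; trans = λ (p , q) (p' , q') → (λ x → H.trans (p x) (p' x)) , G.trans q q' }
            ; ∙-cong = λ {u} {u'} {v} {v'} (p , q) (p' , q') →
                (λ x → H.∙-cong (p x) (H.trans (resp v (G.∙-congˡ q)) (p' _)))
                , G.∙-cong q q' }
          ; assoc = λ u v w →
              (λ x → H.trans (H.assoc _ _ _)
                        (H.∙-congˡ (H.∙-congˡ (resp w (G.sym (G.assoc x (base u) (base v)))))))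
              , G.assoc _ _ _ }
        ; identity = (λ u → (λ x → H.trans (H.identityˡ _) (resp u (G.identityʳ x))) , G.identityˡ _)
                   , (λ u → (λ x → H.identityʳ _) , G.identityʳ _) }
      ; inverse = (λ u → (λ x → H.inverseˡ _) , G.inverseˡ _)
                , (λ u → (λ x → H.trans (H.∙-congˡ (H.⁻¹-cong (resp u
                              (G.trans (G.assoc _ _ _)
                                (G.trans (G.∙-congˡ (G.inverseʳ _)) (G.identityʳ x))))))
                              (H.inverseʳ _))
                         , G.inverseʳ _)
      ; ⁻¹-cong = λ {u} {v} (p , q) →
          (λ x → H.⁻¹-cong (H.trans (resp u (G.∙-congˡ (G.⁻¹-cong q))) (p _)))
          , G.⁻¹-cong q } }

-- Iterated wreath product  C₁ ≀ (C₂ ≀ (⋯ ≀ Cᵣ)⋯)  of a nonempty list C₁ ∷ [C₂ … Cᵣ]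
iteratedWreath : Group 0ℓ 0ℓ → List (Group 0ℓ 0ℓ) → Group 0ℓ 0ℓ
iteratedWreath C []       = C
iteratedWreath C (D ∷ Ds) = C ≀ iteratedWreath D Ds

data Semiabelian {c ℓ : Level} : Group c ℓ → Set (lsuc (c ⊔ ℓ)) where
  abelian    : (A : AbelianGroup c ℓ) → Finite (AbelianGroup.group A) →
               Semiabelian (AbelianGroup.group A)
  semidir    : {G : Group c ℓ} → Semiabelian G →
               (A : AbelianGroup c ℓ) → Finite (AbelianGroup.group A) →
               (φ : Action G (AbelianGroup.group A)) →
               Semiabelian (semidirect (AbelianGroup.group A) G φ)
  image      : {G H : Group c ℓ} → Semiabelian G →
               (f : Group.Carrier G → Group.Carrier H) → IsEpimorphism G H f →
               Semiabelian H

module Submission where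

-- We call a group H "covered" if some such iterated wreath product maps
-- onto it.  The theorem follows by induction on the derivation of
-- semiabelianness once we know that covered groups are closed under
--   (iii) homomorphic images: compose the epimorphisms;
--   (ii)  semidirect products A ⋊ G with A finite abelian: starting from
--         w ↦ (ε , π w) we add the elements of A one at a time.  Given a
--         homomorphism ψ = (α , ρ) : V → A ⋊ G and x ∈ A with xˢ = ε, the map
--           Ψ (f , v) = (∑_{y ∈ V} ρ(y)⁻¹ · x^{f(y)} ∙ α(v) , ρ(v))
--         is a homomorphism ℤ/s ≀ V → A ⋊ G whose image contains the image
--         of ψ together with x times it;
--   (i)   finite abelian groups A are images of A ⋊ 1, and the trivial group
--         is an image of ℤ/1.
-- The sums over V need an exact enumeration of V (a bijection with some
-- Fin k compatible with the equality), so we carry such enumerations for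
-- all cyclic factors and show that they are inherited by wreath products.

open import Defs
open import Level using (Level; 0ℓ; _⊔_) renaming (suc to lsuc)
open import Algebra.Bundles using (Group; AbelianGroup)
open import Algebra.Morphism.Structures using (IsGroupHomomorphism)
import Algebra.Construct.Terminal as Trivial
import Algebra.Morphism.Construct.Terminal as ToTrivial
import Algebra.Morphism.Construct.Composition as Composition
import Algebra.Properties.Group as GroupProperties
import Algebra.Properties.CommutativeSemigroup as CommutativeSemigroupProperties
import Algebra.Properties.CommutativeMonoid.Sum as SumProperties
open import Data.Nat using (ℕ; zero; suc; _+_; _*_; _^_; NonZero)
open import Data.Nat.Properties using (+-assoc; +-comm; +-identityʳ; *-comm; n<1+n; m≤n⇒∃[o]m+o≡n)
open import Data.Nat.DivMod using (_%_; _/_; m%n<n; m%n%n≡m%n; m<n⇒m%n≡m; m*n%n≡0; %-distribˡ-+; %-distribˡ-*; m≡m%n+[m/n]*n)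
open import Data.Integer using (+_)
open import Data.Fin using (Fin; toℕ; fromℕ<; combine; remQuot; funToFin; finToFun; _≟_) renaming (zero to fzero; suc to fsuc)
open import Data.Fin.Properties using (toℕ-fromℕ<; toℕ-injective; toℕ<n; remQuot-combine; combine-remQuot; funToFin-finToFin; finToFun-funToFin; pigeonhole; punchInᵢ≢i)
open import Data.Fin.Permutation using (Permutation′; permutation)
open import Data.List using (List; []; _∷_)
open import Data.List.Relation.Unary.All as All using (All; []; _∷_)
open import Data.Product using (Σ; _×_; _,_; proj₁; proj₂; uncurry)
open import Function using (_∘_)
open import Relation.Nullary using (¬_; yes; no; contradiction)
open import Relation.Binary.PropositionalEquality as ≡ using (_≡_)
import Relation.Binary.Reasoning.Setoid

mkGroupHomomorphism : {a b ℓa ℓb : Level} (G : Group a ℓa) (H : Group b ℓb)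
  (f : Group.Carrier G → Group.Carrier H) →
  (∀ {x y} → Group._≈_ G x y → Group._≈_ H (f x) (f y)) →
  (∀ x y → Group._≈_ H (f (Group._∙_ G x y)) (Group._∙_ H (f x) (f y))) →
  IsGroupHomomorphism (Group.rawGroup G) (Group.rawGroup H) f
mkGroupHomomorphism G H f f-cong f-∙ = record
  { isMonoidHomomorphism = record
    { isMagmaHomomorphism = record { isRelHomomorphism = record { cong = f-cong } ; homo = f-∙ }
    ; ε-homo = f-ε }
  ; ⁻¹-homo = λ x → GroupProperties.inverseˡ-unique H (f (x G.⁻¹)) (f x)
      (H.trans (H.sym (f-∙ (x G.⁻¹) x)) (H.trans (f-cong (G.inverseˡ x)) f-ε)) }
  where
  module G = Group G
  module H = Group H
  f-ε : f G.ε H.≈ H.ε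
  f-ε = GroupProperties.identityˡ-unique H (f G.ε) (f G.ε)
          (H.trans (H.sym (f-∙ G.ε G.ε)) (f-cong (G.identityˡ G.ε)))

epi-∘ : {a b c ℓa ℓb ℓc : Level} {G : Group a ℓa} {H : Group b ℓb} {K : Group c ℓc}
  {f : Group.Carrier G → Group.Carrier H} {g : Group.Carrier H → Group.Carrier K} →
  IsEpimorphism G H f → IsEpimorphism H K g → IsEpimorphism G K (g ∘ f)
epi-∘ {K = K} {f = f} (f-hom , f-onto) (g-hom , g-onto) =
  Composition.isGroupHomomorphism (Group.trans K) f-hom g-hom ,
  λ z → let (y , gy≈z) = g-onto z ; (x , fx≈y) = f-onto y in
        x , Group.trans K (IsGroupHomomorphism.⟦⟧-cong g-hom fx≈y) gy≈z

module Powers {c ℓ : Level} (G : Group c ℓ) where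
  open Group G

  pow-+ : ∀ x m k → powℕ G x (m + k) ≈ powℕ G x m ∙ powℕ G x k
  pow-+ x zero    k = sym (identityˡ _)
  pow-+ x (suc m) k = trans (∙-congˡ (pow-+ x m k)) (sym (assoc _ _ _))

  module _ {x : Carrier} {s : ℕ} .{{_ : NonZero s}} (xˢ≈ε : powℕ G x s ≈ ε) where
    pow-multiple : ∀ q → powℕ G x (q * s) ≈ ε
    pow-multiple zero    = refl
    pow-multiple (suc q) =
      trans (pow-+ x s (q * s)) (trans (∙-cong xˢ≈ε (pow-multiple q)) (identityˡ ε))

    pow-mod : ∀ m → powℕ G x m ≈ powℕ G x (m % s)
    pow-mod m = trans (reflexive (≡.cong (powℕ G x) (m≡m%n+[m/n]*n m s)))
      (trans (pow-+ x (m % s) ((m / s) * s)) (trans (∙-congˡ (pow-multiple (m / s))) (identityʳ _)))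

    pow-cong-mod : ∀ m k → m % s ≡ k % s → powℕ G x m ≈ powℕ G x k
    pow-cong-mod m k m≡k = trans (pow-mod m) (trans (reflexive (≡.cong (powℕ G x) m≡k)) (sym (pow-mod k)))

  -- In a finite group every element has finite order: two of the powers
  -- x⁰, …, x^N must coincide by the pigeonhole principle.
  finite⇒torsion : Finite G → ∀ x → Σ ℕ λ n → powℕ G x (suc n) ≈ ε
  finite⇒torsion (N , e , e-onto) x
    with i , j , i<j , same-index ← pigeonhole (n<1+n N) (λ j → proj₁ (e-onto (powℕ G x (toℕ j))))
    with k , 1+i+k≡j ← m≤n⇒∃[o]m+o≡n i<j
    = k , GroupProperties.identityˡ-unique G _ _ (sym (begin
        powℕ G x (toℕ i)                      ≈⟨ xⁱ≈xʲ ⟩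
        powℕ G x (toℕ j)                      ≡⟨ ≡.cong (powℕ G x) j≡1+k+i ⟩
        powℕ G x (suc k + toℕ i)              ≈⟨ pow-+ x (suc k) (toℕ i) ⟩
        powℕ G x (suc k) ∙ powℕ G x (toℕ i)   ∎))
    where
    open Relation.Binary.Reasoning.Setoid setoid
    xⁱ≈xʲ : powℕ G x (toℕ i) ≈ powℕ G x (toℕ j)
    xⁱ≈xʲ = trans (sym (proj₂ (e-onto _))) (trans (reflexive (≡.cong e same-index)) (proj₂ (e-onto _)))
    j≡1+k+i : toℕ j ≡ suc k + toℕ i
    j≡1+k+i = ≡.trans (≡.sym 1+i+k≡j) (≡.cong suc (+-comm (toℕ i) k))

-- The cyclic group ℤ/(1+n): natural numbers compared modulo 1+n,
-- where the inverse of x is n·x ≡ -x.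
Zmod : ℕ → Group 0ℓ 0ℓ
Zmod n = record
  { Carrier = ℕ
  ; _≈_ = λ x y → x % s ≡ y % s
  ; _∙_ = _+_
  ; ε = 0
  ; _⁻¹ = λ x → n * x
  ; isGroup = record
    { isMonoid = record
      { isSemigroup = record
        { isMagma = record
          { isEquivalence = record { refl = ≡.refl ; sym = ≡.sym ; trans = ≡.trans }
          ; ∙-cong = λ {x} {y} {u} {v} x≈y u≈v → ≡.trans (%-distribˡ-+ x u s)
              (≡.trans (≡.cong₂ (λ p q → (p + q) % s) x≈y u≈v) (≡.sym (%-distribˡ-+ y v s))) }
        ; assoc = λ x y z → ≡.cong (_% s) (+-assoc x y z) }
      ; identity = (λ x → ≡.refl) , (λ x → ≡.cong (_% s) (+-identityʳ x)) }
    ; inverse = (λ x → ≡.trans (≡.cong (_% s) (≡.trans (+-comm (n * x) x) (*-comm s x))) (m*n%n≡0 x s))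
              , (λ x → ≡.trans (≡.cong (_% s) (*-comm s x)) (m*n%n≡0 x s))
    ; ⁻¹-cong = λ {x} {y} x≈y → ≡.trans (%-distribˡ-* n x s)
        (≡.trans (≡.cong (λ p → (n % s * p) % s) x≈y) (≡.sym (%-distribˡ-* n y s))) } }
  where s = suc n

Zmod-finiteCyclic : ∀ n → FiniteCyclic (Zmod n)
Zmod-finiteCyclic n =
  (suc n , toℕ , λ x → fromℕ< (m%n<n x (suc n)) , reduce x) ,
  (1 , λ x → + x , ≡.cong (_% suc n) (≡.sym (powℕ-1 x)))
  where
  reduce : ∀ x → toℕ (fromℕ< (m%n<n x (suc n))) % suc n ≡ x % suc n
  reduce x = ≡.trans (≡.cong (_% suc n) (toℕ-fromℕ< (m%n<n x (suc n)))) (m%n%n≡m%n x (suc n))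
  powℕ-1 : ∀ k → powℕ (Zmod n) 1 k ≡ k
  powℕ-1 zero    = ≡.refl
  powℕ-1 (suc k) = ≡.cong suc (powℕ-1 k)

-- Unlike 'Finite', it lets us sum over
-- the group without repetitions and decide equality of elements.
record Enumeration {c ℓ : Level} (C : Group c ℓ) : Set (c ⊔ ℓ) where
  open Group C
  field
    size          : ℕ
    index         : Carrier → Fin size
    element       : Fin size → Carrier
    element-index : ∀ x → element (index x) ≈ x
    index-element : ∀ i → index (element i) ≡ i
    index-cong    : ∀ {x y} → x ≈ y → index x ≡ index y

  translation : Carrier → Permutation′ size
  translation w = permutation (shift w) (shift (w ⁻¹))
    (shift-cancel (w ⁻¹) w (inverseˡ w)) (shift-cancel w (w ⁻¹) (inverseʳ w))
    where
    shift : Carrier → Fin size → Fin size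
    shift w i = index (element i ∙ w)
    shift-cancel : ∀ w u → w ∙ u ≈ ε → ∀ i → shift u (shift w i) ≡ i
    shift-cancel w u w∙u≈ε i = ≡.trans
      (index-cong (trans (∙-congʳ (element-index _))
        (trans (assoc _ _ _) (trans (∙-congˡ w∙u≈ε) (identityʳ _)))))
      (index-element i)

Zmod-enumeration : ∀ n → Enumeration (Zmod n)
Zmod-enumeration n = record
  { size = s
  ; index = λ x → fromℕ< (m%n<n x s)
  ; element = toℕ
  ; element-index = λ x → ≡.trans (≡.cong (_% s) (toℕ-fromℕ< (m%n<n x s))) (m%n%n≡m%n x s)
  ; index-element = λ i → toℕ-injective (≡.trans (toℕ-fromℕ< (m%n<n (toℕ i) s)) (m<n⇒m%n≡m (toℕ<n i)))
  ; index-cong = λ {x} {y} x≈y → toℕ-injective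
      (≡.trans (toℕ-fromℕ< (m%n<n x s)) (≡.trans x≈y (≡.sym (toℕ-fromℕ< (m%n<n y s))))) }
  where s = suc n

funToFin-cong : ∀ {m n} {f g : Fin m → Fin n} → (∀ j → f j ≡ g j) → funToFin f ≡ funToFin g
funToFin-cong {zero}  f≗g = ≡.refl
funToFin-cong {suc m} f≗g = ≡.cong₂ combine (f≗g fzero) (funToFin-cong (f≗g ∘ fsuc))

-- An element (f , d) of C ≀ D is determined by the indices of the values
-- of f on the enumerated elements of D, together with the index of d:
-- so C ≀ D has an exact enumeration of size |C|^|D| · |D|.
wreath-enumeration : {c ℓc d ℓd : Level} (C : Group c ℓc) (D : Group d ℓd) →
  Enumeration C → Enumeration D → Enumeration (C ≀ D)
wreath-enumeration C D EC ED = record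
  { size = (EC.size ^ ED.size) * ED.size
  ; index = uncurry combine ∘ encode
  ; element = decode ∘ remQuot ED.size
  ; element-index = λ u → ≡.subst (λ p → decode p W.≈ u) (≡.sym (remQuot-combine (proj₁ (encode u)) (proj₂ (encode u)))) (decode-encode u)
  ; index-element = λ i → ≡.trans (≡.cong (uncurry combine) (encode-decode (remQuot ED.size i))) (combine-remQuot {EC.size ^ ED.size} ED.size i)
  ; index-cong = λ {u} {v} (fu≈fv , bu≈bv) → ≡.cong₂ combine (funToFin-cong (λ j → EC.index-cong (fu≈fv (ED.element j)))) (ED.index-cong bu≈bv) }
  where
  module C = Group C
  module D = Group D
  module W = Group (C ≀ D)
  module EC = Enumeration EC
  module ED = Enumeration ED
  open WrEl
  Code = Fin (EC.size ^ ED.size) × Fin ED.size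
  encode : WrEl C D → Code
  encode u = funToFin (λ j → EC.index (fn u (ED.element j))) , ED.index (base u)
  decode : Code → WrEl C D
  decode (f , j) = wr (λ x → EC.element (finToFun f (ED.index x)))
    (λ x≈y → C.reflexive (≡.cong (EC.element ∘ finToFun f) (ED.index-cong x≈y))) (ED.element j)
  decode-encode : ∀ u → decode (encode u) W.≈ u
  decode-encode u =
    (λ x → C.trans (C.reflexive (≡.cong EC.element (finToFun-funToFin _ (ED.index x))))
             (C.trans (EC.element-index _) (resp u (ED.element-index x))))
    , ED.element-index (base u)
  encode-decode : ∀ p → encode (decode p) ≡ p
  encode-decode (f , j) = ≡.cong₂ _,_
    (≡.trans (funToFin-cong (λ j' → ≡.trans (EC.index-element _) (≡.cong (finToFun f) (ED.index-element j'))))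
      (funToFin-finToFin {ED.size} {EC.size} f))
    (ED.index-element j)

iteratedWreath-enumeration : ∀ C Cs → All Enumeration (C ∷ Cs) → Enumeration (iteratedWreath C Cs)
iteratedWreath-enumeration C []       (EC ∷ [])  = EC
iteratedWreath-enumeration C (D ∷ Ds) (EC ∷ EDs) =
  wreath-enumeration C (iteratedWreath D Ds) EC (iteratedWreath-enumeration D Ds EDs)

act-ε : {a ℓa g ℓg : Level} {G : Group g ℓg} {A : Group a ℓa} (φ : Action G A) →
  ∀ x → Group._≈_ A (Action.act φ x (Group.ε A)) (Group.ε A)
act-ε {G = G} {A = A} φ x = GroupProperties.identityʳ-unique A (act x ε) (act x ε)
  (trans (sym (act-hom x ε ε)) (act-cong (Group.refl G) (identityˡ ε)))
  where
  open Group A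
  open Action φ

module FiniteSums {a ℓa v ℓv : Level} (A : AbelianGroup a ℓa)
                  {V : Group v ℓv} (EV : Enumeration V) where
  open AbelianGroup A
  open Enumeration EV
  open SumProperties commutativeMonoid using (sum; sum-cong-≋; ∑-distrib-+; sum-permute; sum-remove; sum-replicate-zero)
  private module V = Group V

  ∑ : (V.Carrier → Carrier) → Carrier
  ∑ F = sum (F ∘ element)

  ∑-cong : ∀ F F' → (∀ y → F y ≈ F' y) → ∑ F ≈ ∑ F'
  ∑-cong F F' F≈F' = sum-cong-≋ (F≈F' ∘ element)

  ∑-distrib : ∀ F F' → ∑ (λ y → F y ∙ F' y) ≈ ∑ F ∙ ∑ F'
  ∑-distrib F F' = ∑-distrib-+ (F ∘ element) (F' ∘ element)

  sum-zero : ∀ {m} {t : Fin m → Carrier} → (∀ i → t i ≈ ε) → sum t ≈ ε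
  sum-zero {m} t≈ε = trans (sum-cong-≋ t≈ε) (sum-replicate-zero m)

  ∑-zero : ∀ F → (∀ y → F y ≈ ε) → ∑ F ≈ ε
  ∑-zero F F≈ε = sum-zero (F≈ε ∘ element)

  ∑-endo : (h : Carrier → Carrier) → (∀ {x y} → x ≈ y → h x ≈ h y) →
    (∀ x y → h (x ∙ y) ≈ h x ∙ h y) → h ε ≈ ε → ∀ F → h (∑ F) ≈ ∑ (h ∘ F)
  ∑-endo h h-cong h-∙ h-ε F = go (F ∘ element)
    where
    go : ∀ {m} (t : Fin m → Carrier) → h (sum t) ≈ sum (h ∘ t)
    go {zero}  t = h-ε
    go {suc m} t = trans (h-∙ _ _) (∙-congˡ (go (t ∘ fsuc)))

  ∑-translate : ∀ F → (∀ {x y} → x V.≈ y → F x ≈ F y) → ∀ w → ∑ (λ y → F (y V.∙ w)) ≈ ∑ F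
  ∑-translate F F-cong w = sym (trans (sum-permute (F ∘ element) (translation w))
    (sum-cong-≋ (λ i → F-cong (element-index (element i V.∙ w)))))

  ∑-single : ∀ F → (∀ {x y} → x V.≈ y → F x ≈ F y) → ∀ y₀ →
    (∀ y → ¬ index y ≡ index y₀ → F y ≈ ε) → ∑ F ≈ F y₀
  ∑-single F F-cong y₀ F-off = trans (sum-single (F ∘ element) (index y₀) off) (F-cong (element-index y₀))
    where
    off : ∀ i → ¬ i ≡ index y₀ → F (element i) ≈ ε
    off i i≢i₀ = F-off (element i) (λ eq → i≢i₀ (≡.trans (≡.sym (index-element i)) eq))
    sum-single : ∀ {m} (t : Fin m → Carrier) i₀ → (∀ i → ¬ i ≡ i₀ → t i ≈ ε) → sum t ≈ t i₀
    sum-single {suc m} t i₀ t-off = trans (sum-remove t)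
      (trans (∙-congˡ (sum-zero (λ j → t-off _ (punchInᵢ≢i i₀ j)))) (identityʳ _))

module Extension {a ℓa g ℓg v ℓv : Level}
  (A : AbelianGroup a ℓa) (G : Group g ℓg) (φ : Action G (AbelianGroup.group A))
  (V : Group v ℓv) (EV : Enumeration V)
  (ψ : Group.Carrier V → Group.Carrier (semidirect (AbelianGroup.group A) G φ))
  (ψ-hom : IsGroupHomomorphism (Group.rawGroup V) (Group.rawGroup (semidirect (AbelianGroup.group A) G φ)) ψ)
  (n : ℕ) (x : AbelianGroup.Carrier A)
  (x-order : AbelianGroup._≈_ A (powℕ (AbelianGroup.group A) x (suc n)) (AbelianGroup.ε A))
  where
  open AbelianGroup A
  open Action φ
  open Enumeration EV
  open FiniteSums A EV
  open WrEl
  open Relation.Binary.Reasoning.Setoid setoid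
  private
    module G = Group G
    module V = Group V
    module ψ = IsGroupHomomorphism ψ-hom
    A⋊G = semidirect group G φ
    module A⋊G = Group A⋊G
    W = Zmod n ≀ V
    module W = Group W
    s = suc n

  α : V.Carrier → Carrier
  α = proj₁ ∘ ψ
  ρ : V.Carrier → G.Carrier
  ρ = proj₂ ∘ ψ

  α-homo : ∀ u w → α (u V.∙ w) ≈ α u ∙ act (ρ u) (α w)
  α-homo u w = proj₁ (ψ.homo u w)
  ρ-cong : ∀ {u w} → u V.≈ w → ρ u G.≈ ρ w
  ρ-cong u≈w = proj₂ (ψ.⟦⟧-cong u≈w)
  ρ-homo : ∀ u w → ρ (u V.∙ w) G.≈ ρ u G.∙ ρ w
  ρ-homo u w = proj₂ (ψ.homo u w)

  κ : ℕ → Carrier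
  κ = powℕ group x
  κ-cong : ∀ m k → m % s ≡ k % s → κ m ≈ κ k
  κ-cong = Powers.pow-cong-mod group x-order

  F : W.Carrier → V.Carrier → Carrier
  F u y = act (ρ y G.⁻¹) (κ (fn u y))

  Ψ : W.Carrier → A⋊G.Carrier
  Ψ u = (∑ (F u) ∙ α (base u) , ρ (base u))

  Ψ-cong : ∀ {u u'} → u W.≈ u' → Ψ u A⋊G.≈ Ψ u'
  Ψ-cong {u} {u'} (fn≈ , base≈) =
    ∙-cong (∑-cong (F u) (F u') (λ y → act-cong G.refl (κ-cong (fn u y) (fn u' y) (fn≈ y)))) (proj₁ (ψ.⟦⟧-cong base≈)) ,
    ρ-cong base≈

  -- Translating the summand of u₂ by v₁ turns its sum into its ρ(v₁)-image:
  -- this is where the twisting by ρ(y)⁻¹ in F is needed.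
  ∑-shift : ∀ u v₁ → ∑ (λ y → act (ρ y G.⁻¹) (κ (fn u (y V.∙ v₁)))) ≈ act (ρ v₁) (∑ (F u))
  ∑-shift u v₁ = begin
      ∑ (λ y → act (ρ y G.⁻¹) (κ (fn u (y V.∙ v₁))))
    ≈⟨ ∑-cong (λ y → act (ρ y G.⁻¹) (κ (fn u (y V.∙ v₁)))) (H ∘ (V._∙ v₁))
               (λ y → act-cong (G.⁻¹-cong (ρ-cong (V.sym (cancel y)))) refl) ⟩
      ∑ (λ y → H (y V.∙ v₁))
    ≈⟨ ∑-translate H H-cong v₁ ⟩
      ∑ H
    ≈⟨ ∑-cong H (act (ρ v₁) ∘ F u) (λ y → trans (act-cong (H-twist y) refl) (act-comp _ _ _)) ⟩
      ∑ (λ y → act (ρ v₁) (F u y))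
    ≈⟨ ∑-endo (act (ρ v₁)) (act-cong G.refl) (act-hom (ρ v₁)) (act-ε φ (ρ v₁)) (F u) ⟨
      act (ρ v₁) (∑ (F u))
    ∎
    where
    H : V.Carrier → Carrier
    H y = act (ρ (y V.∙ v₁ V.⁻¹) G.⁻¹) (κ (fn u y))
    H-cong : ∀ {y z} → y V.≈ z → H y ≈ H z
    H-cong {y} {z} y≈z = act-cong (G.⁻¹-cong (ρ-cong (V.∙-congʳ y≈z))) (κ-cong (fn u y) (fn u z) (resp u y≈z))
    cancel : ∀ y → (y V.∙ v₁) V.∙ v₁ V.⁻¹ V.≈ y
    cancel y = V.trans (V.assoc _ _ _) (V.trans (V.∙-congˡ (V.inverseʳ v₁)) (V.identityʳ y))
    H-twist : ∀ y → ρ (y V.∙ v₁ V.⁻¹) G.⁻¹ G.≈ ρ v₁ G.∙ ρ y G.⁻¹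
    H-twist y = G.trans (G.⁻¹-cong (G.trans (ρ-homo y (v₁ V.⁻¹)) (G.∙-congˡ (proj₂ (ψ.⁻¹-homo v₁)))))
      (G.trans (GroupProperties.⁻¹-anti-homo-∙ G (ρ y) (ρ v₁ G.⁻¹))
               (G.∙-congʳ (GroupProperties.⁻¹-involutive G (ρ v₁))))

  Ψ-homo : ∀ u₁ u₂ → Ψ (u₁ W.∙ u₂) A⋊G.≈ (Ψ u₁ A⋊G.∙ Ψ u₂)
  Ψ-homo u₁ u₂ = (begin
      ∑ (F (u₁ W.∙ u₂)) ∙ α (v₁ V.∙ v₂)
    ≈⟨ ∙-cong (∑-cong (F (u₁ W.∙ u₂)) (λ y → F u₁ y ∙ act (ρ y G.⁻¹) (κ (fn u₂ (y V.∙ v₁))))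
                (λ y → trans (act-cong G.refl (Powers.pow-+ group x (fn u₁ y) _)) (act-hom _ _ _)))
              (α-homo v₁ v₂) ⟩
      ∑ (λ y → F u₁ y ∙ act (ρ y G.⁻¹) (κ (fn u₂ (y V.∙ v₁)))) ∙ (α v₁ ∙ act (ρ v₁) (α v₂))
    ≈⟨ ∙-congʳ (trans (∑-distrib (F u₁) (λ y → act (ρ y G.⁻¹) (κ (fn u₂ (y V.∙ v₁))))) (∙-congˡ (∑-shift u₂ v₁))) ⟩
      (∑ (F u₁) ∙ act (ρ v₁) (∑ (F u₂))) ∙ (α v₁ ∙ act (ρ v₁) (α v₂))
    ≈⟨ CommutativeSemigroupProperties.interchange commutativeSemigroup _ _ _ _ ⟩
      (∑ (F u₁) ∙ α v₁) ∙ (act (ρ v₁) (∑ (F u₂)) ∙ act (ρ v₁) (α v₂))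
    ≈⟨ ∙-congˡ (act-hom _ _ _) ⟨
      (∑ (F u₁) ∙ α v₁) ∙ act (ρ v₁) (∑ (F u₂) ∙ α v₂)
    ∎) , ρ-homo v₁ v₂
    where
    v₁ = base u₁
    v₂ = base u₂

  Ψ-isHom : IsGroupHomomorphism W.rawGroup A⋊G.rawGroup Ψ
  Ψ-isHom = mkGroupHomomorphism W A⋊G Ψ (λ {u} {u'} → Ψ-cong {u} {u'}) Ψ-homo

  constant-zero : V.Carrier → W.Carrier
  constant-zero v = wr (λ _ → 0) (λ _ → ≡.refl) v

  Ψ-extends-ψ : ∀ v → Ψ (constant-zero v) A⋊G.≈ ψ v
  Ψ-extends-ψ v = trans (∙-congʳ (∑-zero (F (constant-zero v)) (λ y → act-ε φ _))) (identityˡ _) , G.refl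

  indicator : Fin size → ℕ
  indicator i with i ≟ index V.ε
  ... | yes _ = 1
  ... | no  _ = 0

  indicator-off : ∀ i → ¬ i ≡ index V.ε → indicator i ≡ 0
  indicator-off i i≢ε with i ≟ index V.ε
  ... | yes i≡ε = contradiction i≡ε i≢ε
  ... | no  _   = ≡.refl

  indicator-on : indicator (index V.ε) ≡ 1
  indicator-on with index V.ε ≟ index V.ε
  ... | yes _   = ≡.refl
  ... | no  ε≢ε = contradiction ≡.refl ε≢ε

  point-mass : V.Carrier → W.Carrier
  point-mass v = wr (indicator ∘ index) (λ y≈z → ≡.cong (λ i → indicator i % s) (index-cong y≈z)) v

  Ψ-point-mass : ∀ v → Ψ (point-mass v) A⋊G.≈ (x ∙ α v , ρ v)
  Ψ-point-mass v = ∙-congʳ ∑≈x , G.refl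
    where
    F-cong : ∀ {y z} → y V.≈ z → F (point-mass v) y ≈ F (point-mass v) z
    F-cong y≈z = act-cong (G.⁻¹-cong (ρ-cong y≈z)) (reflexive (≡.cong (κ ∘ indicator) (index-cong y≈z)))
    ρε⁻¹≈ε : ρ V.ε G.⁻¹ G.≈ G.ε
    ρε⁻¹≈ε = G.trans (G.⁻¹-cong (proj₂ ψ.ε-homo)) (GroupProperties.ε⁻¹≈ε G)
    ∑≈x : ∑ (F (point-mass v)) ≈ x
    ∑≈x = begin
        ∑ (F (point-mass v))
      ≈⟨ ∑-single _ F-cong V.ε (λ y y≢ε → trans (act-cong G.refl (reflexive (≡.cong κ (indicator-off _ y≢ε)))) (act-ε φ _)) ⟩
        act (ρ V.ε G.⁻¹) (κ (indicator (index V.ε)))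
      ≈⟨ act-cong ρε⁻¹≈ε (reflexive (≡.cong κ indicator-on)) ⟩
        act G.ε (x ∙ ε)
      ≈⟨ trans (act-id _) (identityʳ x) ⟩
        x
      ∎

CyclicFactor : Group 0ℓ 0ℓ → Set
CyclicFactor C = FiniteCyclic C × Enumeration C

record WreathHom {c ℓ : Level} (H : Group c ℓ) : Set (lsuc 0ℓ ⊔ c ⊔ ℓ) where
  open Group H
  field
    C₁      : Group 0ℓ 0ℓ
    Cs      : List (Group 0ℓ 0ℓ)
    factors : All CyclicFactor (C₁ ∷ Cs)
    map     : Group.Carrier (iteratedWreath C₁ Cs) → Carrier
    isHom   : IsGroupHomomorphism (Group.rawGroup (iteratedWreath C₁ Cs)) rawGroup map

  Hits : Carrier → Set ℓ
  Hits y = Σ (Group.Carrier (iteratedWreath C₁ Cs)) λ w → map w ≈ y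

  Hits-resp : ∀ {y z} → y ≈ z → Hits y → Hits z
  Hits-resp y≈z (w , w↦y) = w , trans w↦y y≈z

open WreathHom using (Hits; Hits-resp)

Covered : {c ℓ : Level} → Group c ℓ → Set (lsuc 0ℓ ⊔ c ⊔ ℓ)
Covered H = Σ (WreathHom H) λ θ → ∀ y → Hits θ y

covered-image : {c ℓ c' ℓ' : Level} {G : Group c ℓ} {H : Group c' ℓ'}
  {f : Group.Carrier G → Group.Carrier H} → Covered G → IsEpimorphism G H f → Covered H
covered-image {G = G} {H} {f} (θ , θ-onto) f-epi =
  record { WreathHom θ hiding (map; isHom) ; map = f ∘ WreathHom.map θ ; isHom = proj₁ composite } ,
  proj₂ composite
  where
  open WreathHom θ using (C₁; Cs)
  composite : IsEpimorphism (iteratedWreath C₁ Cs) H (f ∘ WreathHom.map θ)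
  composite = epi-∘ {G = iteratedWreath C₁ Cs} {H = G} {H} {WreathHom.map θ} {f} (WreathHom.isHom θ , θ-onto) f-epi

covered-trivial : {c ℓ : Level} → Covered (Trivial.group {c} {ℓ})
covered-trivial {c} {ℓ} = record
  { C₁ = Zmod 0 ; Cs = [] ; factors = (Zmod-finiteCyclic 0 , Zmod-enumeration 0) ∷ []
  ; map = ToTrivial.one {c} {ℓ} ; isHom = ToTrivial.isGroupHomomorphism {c} {ℓ} _ }
  , λ _ → 0 , _

module SemidirectCover {a ℓa g ℓg : Level}
  (A : AbelianGroup a ℓa) (G : Group g ℓg) (φ : Action G (AbelianGroup.group A)) where
  open AbelianGroup A
  private
    module G = Group G
    A⋊G = semidirect group G φ
    module A⋊G = Group A⋊G

  include : Covered G → Σ (WreathHom A⋊G) λ θ → ∀ g → Hits θ (ε , g)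
  include (θ , θ-onto) =
    record { WreathHom θ hiding (map; isHom) ; map = ι ∘ θ.map ; isHom = Composition.isGroupHomomorphism A⋊G.trans θ.isHom ι-isHom } ,
    λ g → let (w , w↦g) = θ-onto g in w , (refl , w↦g)
    where
    module θ = WreathHom θ
    ι : G.Carrier → A⋊G.Carrier
    ι h = (ε , h)
    ι-isHom : IsGroupHomomorphism G.rawGroup A⋊G.rawGroup ι
    ι-isHom = mkGroupHomomorphism G A⋊G ι (λ h≈h' → refl , h≈h')
      (λ h h' → sym (trans (identityˡ _) (act-ε φ h)) , G.refl)
      where open Action φ

  extend : (θ : WreathHom A⋊G) (x : Carrier) → Σ ℕ (λ n → powℕ group x (suc n) ≈ ε) →
    Σ (WreathHom A⋊G) λ Θ → ∀ {y h} → Hits θ (y , h) → Hits Θ (y , h) × Hits Θ (x ∙ y , h)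
  extend θ x (n , x-order) =
    record { C₁ = Zmod n ; Cs = θ.C₁ ∷ θ.Cs
           ; factors = (Zmod-finiteCyclic n , Zmod-enumeration n) ∷ θ.factors
           ; map = E.Ψ ; isHom = E.Ψ-isHom } ,
    λ (w , w↦yh) →
      (E.constant-zero w , A⋊G.trans (E.Ψ-extends-ψ w) w↦yh) ,
      (E.point-mass w , A⋊G.trans (E.Ψ-point-mass w) (∙-congˡ (proj₁ w↦yh) , proj₂ w↦yh))
    where
    module θ = WreathHom θ
    module E = Extension A G φ (iteratedWreath θ.C₁ θ.Cs)
      (iteratedWreath-enumeration θ.C₁ θ.Cs (All.map proj₂ θ.factors)) θ.map θ.isHom n x x-order

  reach : Covered G → Finite group → ∀ m (e : Fin m → Carrier) →
    Σ (WreathHom A⋊G) λ θ → (∀ h → Hits θ (ε , h)) × (∀ i h → Hits θ (e i , h))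
  reach G-covered A-finite zero e =
    let (θ , hits-ε) = include G-covered in θ , hits-ε , λ ()
  reach G-covered A-finite (suc m) e
    with θ , hits-ε , hits-e ← reach G-covered A-finite m (e ∘ fsuc)
    with Θ , absorb ← extend θ (e fzero) (Powers.finite⇒torsion group A-finite (e fzero))
    = Θ , (λ h → proj₁ (absorb (hits-ε h))) , hits-e'
    where
    hits-e' : ∀ i h → Hits Θ (e i , h)
    hits-e' fzero    h = Hits-resp Θ (identityʳ _ , G.refl) (proj₂ (absorb (hits-ε h)))
    hits-e' (fsuc i) h = proj₁ (absorb (hits-e i h))

  covered-semidirect : Covered G → Finite group → Covered A⋊G
  covered-semidirect G-covered A-finite@(N , e , e-onto)
    with θ , _ , hits-e ← reach G-covered A-finite N e
    = θ , λ (y , h) → let (i , eᵢ≈y) = e-onto y in Hits-resp θ (eᵢ≈y , G.refl) (hits-e i h)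

covered-abelian : {c ℓ : Level} (A : AbelianGroup c ℓ) → Finite (AbelianGroup.group A) →
  Covered (AbelianGroup.group A)
covered-abelian {c} {ℓ} A A-finite =
  covered-image (SemidirectCover.covered-semidirect A 𝟙 trivial-action covered-trivial A-finite)
    (mkGroupHomomorphism A⋊𝟙 group proj₁ proj₁ (λ _ _ → refl) , λ y → (y , _) , refl)
  where
  open AbelianGroup A
  𝟙 = Trivial.group {c} {ℓ}
  trivial-action : Action 𝟙 group
  trivial-action = record { act = λ _ y → y ; act-cong = λ _ y≈z → y≈z
    ; act-hom = λ _ _ _ → refl ; act-id = λ _ → refl ; act-comp = λ _ _ _ → refl }
  A⋊𝟙 = semidirect group 𝟙 trivial-action

semiabelian⇒covered : {c ℓ : Level} (G : Group c ℓ) → Semiabelian G → Covered G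
semiabelian⇒covered _ (abelian A A-finite) = covered-abelian A A-finite
semiabelian⇒covered _ (semidir {G} G-semiabelian A A-finite φ) =
  SemidirectCover.covered-semidirect A G φ (semiabelian⇒covered G G-semiabelian) A-finite
semiabelian⇒covered _ (image {G} G-semiabelian f f-epi) =
  covered-image (semiabelian⇒covered G G-semiabelian) f-epi

lemma3p1 : {c ℓ : Level} (G : Group c ℓ) → Semiabelian G →
  Σ (Group 0ℓ 0ℓ) λ C₁ → Σ (List (Group 0ℓ 0ℓ)) λ Cs →
    All FiniteCyclic (C₁ ∷ Cs) ×
    Σ (Group.Carrier (iteratedWreath C₁ Cs) → Group.Carrier G) λ f →
      IsEpimorphism (iteratedWreath C₁ Cs) G f
lemma3p1 G G-semiabelian =
  let (θ , θ-onto) = semiabelian⇒covered G G-semiabelian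
      open WreathHom θ
  in C₁ , Cs , All.map proj₁ factors , map , isHom , θ-onto
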